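{- Let $(S,\cdot)$ be a partial semigroup and let $(Q,\le,\cdot)$ be a quantale. Then $(Q^S,\le,\cdot)$, the set of all functions $S\to Q$ ordered pointwise and equipped with convolution as multiplication, is a quantale; if $Q$ is distributive, so is $Q^S$. Moreover, if $S$ and $Q$ are both commutative then $Q^S$ is commutative, and if $S$ is a partial monoid and $Q$ is unital then $Q^S$ is unital with unit $\mathbb{1}$.
   Context: A partial semigroup is a set $S$ with a partial binary operation $\cdot$ (formally a semigroup structure on $S\cup\{\bot\}$ with $\bot\notin S$ absorbing, $x\cdot\bot=\bot=\bot\cdot x$; "$x\cdot y$ undefined" means $x\cdot y=\bot$) that is associative; a partial monoid additionally has a unit $1\in S$; it is commutative if $x\cdot y=y\cdot x$ for all $x,y$. A quantale $(Q,\le,\cdot)$ is a complete lattice with an associative multiplication distributing over arbitrary suprema on both sides: $x\cdot\sum_i y_i=\sum_i x\cdot y_i$ and $(\sum_i x_i)\cdot y=\sum_i x_i\cdot y$. It is unital if the multiplication has a unit $1$, commutative if the multiplication is, and distributive if $x\sqcap\sum_i y_i=\sum_i(x\sqcap y_i)$ and $x+\prod_i y_i=\prod_i(x+y_i)$ hold, where $+$/$\sum$ are suprema and $\sqcap$/$\prod$ infima. On $Q^S$: $f\le g$ iff $f(x)\le g(x)$ for all $x\in S$; suprema and infima are pointwise, $(\sum_i f_i)(x)=\sum_i f_i(x)$; convolution is $(f\cdot g)(x)=\sum_{x=y\cdot z} f(y)\cdot g(z)$, the supremum over all pairs $y,z\in S$ with $y\cdot z$ defined and equal to $x$; the unit is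 $\mathbb{1}(x)=1$ if $x=1$ and $\mathbb{1}(x)=0$ otherwise, where $0$ is the least element of $Q$. -}

module Defs where

open import Level using (Level; _⊔_; Lift; lift; lower) renaming (suc to lsuc)
open import Data.Maybe using (Maybe; just; nothing; _>>=_)
open import Data.Product using (Σ; _×_; _,_; proj₁; proj₂)
open import Data.Bool using (Bool; true; false; if_then_else_)
open import Relation.Binary.PropositionalEquality using (_≡_)
open import Relation.Binary.Core using (Rel)
open import Relation.Binary.Structures using (IsPartialOrder)

-- Partial semigroups: the partial operation returns `Maybe S`;
-- `nothing` plays the role of the absorbing ⊥ ("undefined").

record PartialSemigroup (s : Level) : Set (lsuc s) where
  field
    Elt   : Set s
    _·_   : Elt → Elt → Maybe Elt
    ·-assoc : ∀ x y z →
      ((x · y) >>= λ w → w · z) ≡ ((y · z) >>= λ w → x · w)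

PSCommutative : ∀ {s} → PartialSemigroup s → Set s
PSCommutative PS = ∀ x y → x · y ≡ y · x
  where open PartialSemigroup PS

PSUnit : ∀ {s} (PS : PartialSemigroup s) → PartialSemigroup.Elt PS → Set s
PSUnit PS e = ∀ x → (e · x ≡ just x) × (x · e ≡ just x)
  where open PartialSemigroup PS

-- Complete lattices are given by their order together with
-- operations of arbitrary suprema ⋁ and infima ⋀ of families indexed by
-- types in universe level i (characterised by their universal properties).

module _ {c ℓ₁ ℓ₂ i : Level} {A : Set c} where

  record IsQuantale (_≈_ : Rel A ℓ₁) (_≤_ : Rel A ℓ₂)
                    (⋁ ⋀ : {I : Set i} → (I → A) → A)
                    (_∙_ : A → A → A) : Set (c ⊔ ℓ₁ ⊔ ℓ₂ ⊔ lsuc i) where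
    field
      isPartialOrder : IsPartialOrder _≈_ _≤_
      ⋁-upper    : ∀ {I : Set i} (f : I → A) (j : I) → f j ≤ ⋁ f
      ⋁-least    : ∀ {I : Set i} (f : I → A) (x : A) → (∀ j → f j ≤ x) → ⋁ f ≤ x
      ⋀-lower    : ∀ {I : Set i} (f : I → A) (j : I) → ⋀ f ≤ f j
      ⋀-greatest : ∀ {I : Set i} (f : I → A) (x : A) → (∀ j → x ≤ f j) → x ≤ ⋀ f
      ∙-cong     : ∀ {x x′ y y′} → x ≈ x′ → y ≈ y′ → (x ∙ y) ≈ (x′ ∙ y′)
      ∙-assoc    : ∀ x y z → ((x ∙ y) ∙ z) ≈ (x ∙ (y ∙ z))
      ∙-distribˡ-⋁ : ∀ x {I : Set i} (f : I → A) → (x ∙ ⋁ f) ≈ ⋁ (λ j → x ∙ f j)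
      ∙-distribʳ-⋁ : ∀ {I : Set i} (f : I → A) y → (⋁ f ∙ y) ≈ ⋁ (λ j → f j ∙ y)

module _ {c ℓ₁ i : Level} {A : Set c} where

  join : ({I : Set i} → (I → A) → A) → A → A → A
  join ⋁ x y = ⋁ {Lift i Bool} (λ b → if lower b then x else y)

  meet : ({I : Set i} → (I → A) → A) → A → A → A
  meet ⋀ x y = ⋀ {Lift i Bool} (λ b → if lower b then x else y)

  Distributive : (_≈_ : Rel A ℓ₁) (⋁ ⋀ : {I : Set i} → (I → A) → A) → Set (c ⊔ ℓ₁ ⊔ lsuc i)
  Distributive _≈_ ⋁ ⋀ =
    (∀ x {I : Set i} (f : I → A) → meet ⋀ x (⋁ f) ≈ ⋁ (λ j → meet ⋀ x (f j)))
    × (∀ x {I : Set i} (f : I → A) → join ⋁ x (⋀ f) ≈ ⋀ (λ j → join ⋁ x (f j)))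

module _ {c ℓ₁ : Level} {A : Set c} where

  Commutative : (_≈_ : Rel A ℓ₁) (_∙_ : A → A → A) → Set (c ⊔ ℓ₁)
  Commutative _≈_ _∙_ = ∀ x y → (x ∙ y) ≈ (y ∙ x)

  IsUnit : (_≈_ : Rel A ℓ₁) (_∙_ : A → A → A) → A → Set (c ⊔ ℓ₁)
  IsUnit _≈_ _∙_ u = ∀ x → ((u ∙ x) ≈ x) × ((x ∙ u) ≈ x)

record Quantale (c ℓ₁ ℓ₂ i : Level) : Set (lsuc (c ⊔ ℓ₁ ⊔ ℓ₂ ⊔ i)) where
  field
    Carrier : Set c
    _≈_     : Rel Carrier ℓ₁
    _≤_     : Rel Carrier ℓ₂
    ⋁       : {I : Set i} → (I → Carrier) → Carrier
    ⋀       : {I : Set i} → (I → Carrier) → Carrier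
    _∙_     : Carrier → Carrier → Carrier
    isQuantale : IsQuantale _≈_ _≤_ ⋁ ⋀ _∙_

module FunctionQuantale {c ℓ₁ ℓ₂ i : Level}
         (PS : PartialSemigroup i) (Q : Quantale c ℓ₁ ℓ₂ i) where
  open PartialSemigroup PS
  open Quantale Q

  QS : Set (i ⊔ c)
  QS = Elt → Carrier

  _≈ᶠ_ : Rel QS (i ⊔ ℓ₁)
  f ≈ᶠ g = ∀ x → f x ≈ g x

  _≤ᶠ_ : Rel QS (i ⊔ ℓ₂)
  f ≤ᶠ g = ∀ x → f x ≤ g x

  ⋁ᶠ : {I : Set i} → (I → QS) → QS
  ⋁ᶠ F x = ⋁ (λ j → F j x)

  ⋀ᶠ : {I : Set i} → (I → QS) → QS
  ⋀ᶠ F x = ⋀ (λ j → F j x)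

  _*_ : QS → QS → QS
  (f * g) x = ⋁ {Σ (Elt × Elt) (λ p → proj₁ p · proj₂ p ≡ just x)}
                (λ q → f (proj₁ (proj₁ q)) ∙ g (proj₂ (proj₁ q)))

  -- 𝟙(x) = 1 if x = e, and 0 (= ⋁ ∅) otherwise; constructively written as
  -- the supremum of the constant family u over the proofs of x ≡ e.
  𝟙 : Elt → Carrier → QS
  𝟙 e u x = ⋁ {x ≡ e} (λ _ → u)

module Submission where

open import Defs
open import Level using (Level; Lift; lift; lower)
open import Data.Bool using (Bool; true; false; if_then_else_)
open import Data.Maybe using (Maybe; just; nothing; _>>=_)
open import Data.Maybe.Properties using (just-injective)
open import Data.Product using (_×_; Σ; _,_; proj₁; proj₂)
open import Relation.Binary.PropositionalEquality as P using (_≡_)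
open import Relation.Binary.Structures using (IsPartialOrder)

module QuantaleProperties {c ℓ₁ ℓ₂ i : Level} (Q : Quantale c ℓ₁ ℓ₂ i) where
  open Quantale Q
  open IsQuantale isQuantale
  open IsPartialOrder isPartialOrder

  ≤-⋁ : ∀ {I : Set i} {f : I → Carrier} {y} j → y ≤ f j → y ≤ ⋁ f
  ≤-⋁ {f = f} j y≤fj = trans y≤fj (⋁-upper f j)

  ⋁-mono : ∀ {I : Set i} {f g : I → Carrier} → (∀ j → f j ≤ g j) → ⋁ f ≤ ⋁ g
  ⋁-mono {f = f} {g} f≤g = ⋁-least f (⋁ g) (λ j → ≤-⋁ j (f≤g j))

  ⋀-mono : ∀ {I : Set i} {f g : I → Carrier} → (∀ j → f j ≤ g j) → ⋀ f ≤ ⋀ g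
  ⋀-mono {f = f} {g} f≤g = ⋀-greatest g (⋀ f) (λ j → trans (⋀-lower f j) (f≤g j))

  ⋁-cong : ∀ {I : Set i} {f g : I → Carrier} → (∀ j → f j ≈ g j) → ⋁ f ≈ ⋁ g
  ⋁-cong f≈g = antisym (⋁-mono (λ j → reflexive (f≈g j)))
                       (⋁-mono (λ j → reflexive (Eq.sym (f≈g j))))

  ⋀-cong : ∀ {I : Set i} {f g : I → Carrier} → (∀ j → f j ≈ g j) → ⋀ f ≈ ⋀ g
  ⋀-cong f≈g = antisym (⋀-mono (λ j → reflexive (f≈g j)))
                       (⋀-mono (λ j → reflexive (Eq.sym (f≈g j))))

  ⋁-swap : ∀ {I J : Set i} (F : I → J → Carrier) →
           ⋁ (λ j → ⋁ (λ k → F j k)) ≈ ⋁ (λ k → ⋁ (λ j → F j k))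
  ⋁-swap F = antisym
    (⋁-least _ _ λ j → ⋁-least _ _ λ k → ≤-⋁ k (≤-⋁ j refl))
    (⋁-least _ _ λ k → ⋁-least _ _ λ j → ≤-⋁ j (≤-⋁ k refl))

  ∙⋁-least : ∀ x {I : Set i} (F : I → Carrier) {z} → (∀ j → (x ∙ F j) ≤ z) → (x ∙ ⋁ F) ≤ z
  ∙⋁-least x F bound = trans (reflexive (∙-distribˡ-⋁ x F)) (⋁-least _ _ bound)

  ⋁∙-least : ∀ {I : Set i} (F : I → Carrier) y {z} → (∀ j → (F j ∙ y) ≤ z) → (⋁ F ∙ y) ≤ z
  ⋁∙-least F y bound = trans (reflexive (∙-distribʳ-⋁ F y)) (⋁-least _ _ bound)

  -- If y ≤ y′ then y′ is the join of y and y′; distributivity over this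
  -- binary join makes multiplication monotone in each argument.
  private
    pair : Carrier → Carrier → Lift i Bool → Carrier
    pair y y′ b = if lower b then y else y′

    join-of-≤ : ∀ {y y′} → y ≤ y′ → y′ ≈ ⋁ (pair y y′)
    join-of-≤ {y} {y′} y≤y′ =
      antisym (⋁-upper (pair y y′) (lift false)) (⋁-least _ _ below)
      where
      below : ∀ b → pair y y′ b ≤ y′
      below (lift true)  = y≤y′
      below (lift false) = refl

  ∙-monoʳ : ∀ x {y y′} → y ≤ y′ → (x ∙ y) ≤ (x ∙ y′)
  ∙-monoʳ x {y} {y′} y≤y′ =
    trans (≤-⋁ (lift true) refl)
          (reflexive (Eq.sym (Eq.trans (∙-cong Eq.refl (join-of-≤ y≤y′))
                                       (∙-distribˡ-⋁ x (pair y y′)))))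

  ∙-monoˡ : ∀ {y y′} x → y ≤ y′ → (y ∙ x) ≤ (y′ ∙ x)
  ∙-monoˡ {y} {y′} x y≤y′ =
    trans (≤-⋁ (lift true) refl)
          (reflexive (Eq.sym (Eq.trans (∙-cong (join-of-≤ y≤y′) Eq.refl)
                                       (∙-distribʳ-⋁ (pair y y′) x))))

module PartialSemigroupProperties {s : Level} (PS : PartialSemigroup s) where
  open PartialSemigroup PS

  private
    bind-just : ∀ (m : Maybe Elt) {k : Elt → Maybe Elt} {x} → (m >>= k) ≡ just x →
                Σ Elt λ v → (m ≡ just v) × (k v ≡ just x)
    bind-just nothing ()
    bind-just (just v) kv≡x = v , P.refl , kv≡x

  reassocʳ : ∀ {a b z w x} → a · b ≡ just w → w · z ≡ just x →
             Σ Elt λ v → (b · z ≡ just v) × (a · v ≡ just x)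
  reassocʳ {a} {b} {z} ab≡w wz≡x = bind-just (b · z) (P.trans (P.sym (·-assoc a b z))
    (P.trans (P.cong (_>>= λ w → w · z) ab≡w) wz≡x))

  reassocˡ : ∀ {a b z v x} → b · z ≡ just v → a · v ≡ just x →
             Σ Elt λ w → (a · b ≡ just w) × (w · z ≡ just x)
  reassocˡ {a} {b} {z} bz≡v av≡x = bind-just (a · b) (P.trans (·-assoc a b z)
    (P.trans (P.cong (_>>= λ v → a · v) bz≡v) av≡x))

module ConvolutionQuantale {c ℓ₁ ℓ₂ i : Level} (PS : PartialSemigroup i) (Q : Quantale c ℓ₁ ℓ₂ i) where
  open FunctionQuantale PS Q
  open Quantale Q
  open PartialSemigroup PS
  open IsQuantale isQuantale
  open IsPartialOrder isPartialOrder
  open QuantaleProperties Q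
  open PartialSemigroupProperties PS

  *-upper : ∀ f g {a b x} → a · b ≡ just x → (f a ∙ g b) ≤ (f * g) x
  *-upper f g ab≡x = ≤-⋁ (_ , ab≡x) refl

  *-least : ∀ f g {x z} → (∀ a b → a · b ≡ just x → (f a ∙ g b) ≤ z) → (f * g) x ≤ z
  *-least f g bound = ⋁-least _ _ λ { ((a , b) , ab≡x) → bound a b ab≡x }

  ≤ᶠ-isPartialOrder : IsPartialOrder _≈ᶠ_ _≤ᶠ_
  ≤ᶠ-isPartialOrder = record
    { isPreorder = record
      { isEquivalence = record
        { refl  = λ x → Eq.refl
        ; sym   = λ f≈g x → Eq.sym (f≈g x)
        ; trans = λ f≈g g≈h x → Eq.trans (f≈g x) (g≈h x) }
      ; reflexive = λ f≈g x → reflexive (f≈g x)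
      ; trans     = λ f≤g g≤h x → trans (f≤g x) (g≤h x) }
    ; antisym = λ f≤g g≤f x → antisym (f≤g x) (g≤f x) }

  *-cong : ∀ {f f′ g g′} → f ≈ᶠ f′ → g ≈ᶠ g′ → (f * g) ≈ᶠ (f′ * g′)
  *-cong f≈f′ g≈g′ x = ⋁-cong λ { ((a , b) , _) → ∙-cong (f≈f′ a) (g≈g′ b) }

  *-assoc : ∀ f g h → ((f * g) * h) ≈ᶠ (f * (g * h))
  *-assoc f g h x = antisym
    (*-least (f * g) h λ w z wz≡x → ⋁∙-least _ (h z) λ { ((a , b) , ab≡w) →
      let (v , bz≡v , av≡x) = reassocʳ ab≡w wz≡x in
      trans (reflexive (∙-assoc (f a) (g b) (h z)))
            (trans (∙-monoʳ (f a) (*-upper g h bz≡v)) (*-upper f (g * h) av≡x)) })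
    (*-least f (g * h) λ a v av≡x → ∙⋁-least (f a) _ λ { ((b , z) , bz≡v) →
      let (w , ab≡w , wz≡x) = reassocˡ bz≡v av≡x in
      trans (reflexive (Eq.sym (∙-assoc (f a) (g b) (h z))))
            (trans (∙-monoˡ (h z) (*-upper f g ab≡w)) (*-upper (f * g) h wz≡x)) })

  *-distribˡ-⋁ᶠ : ∀ f {I : Set i} (G : I → QS) → (f * ⋁ᶠ G) ≈ᶠ ⋁ᶠ (λ j → f * G j)
  *-distribˡ-⋁ᶠ f G x = Eq.trans
    (⋁-cong λ { ((a , b) , _) → ∙-distribˡ-⋁ (f a) (λ j → G j b) }) (⋁-swap _)

  *-distribʳ-⋁ᶠ : ∀ {I : Set i} (G : I → QS) h → (⋁ᶠ G * h) ≈ᶠ ⋁ᶠ (λ j → G j * h)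
  *-distribʳ-⋁ᶠ G h x = Eq.trans
    (⋁-cong λ { ((a , b) , _) → ∙-distribʳ-⋁ (λ j → G j a) (h b) }) (⋁-swap _)

  isQuantaleᶠ : IsQuantale _≈ᶠ_ _≤ᶠ_ ⋁ᶠ ⋀ᶠ _*_
  isQuantaleᶠ = record
    { isPartialOrder = ≤ᶠ-isPartialOrder
    ; ⋁-upper        = λ F j x → ⋁-upper (λ j → F j x) j
    ; ⋁-least        = λ F g bound x → ⋁-least (λ j → F j x) (g x) (λ j → bound j x)
    ; ⋀-lower        = λ F j x → ⋀-lower (λ j → F j x) j
    ; ⋀-greatest     = λ F g bound x → ⋀-greatest (λ j → F j x) (g x) (λ j → bound j x)
    ; ∙-cong         = *-cong
    ; ∙-assoc        = *-assoc
    ; ∙-distribˡ-⋁   = *-distribˡ-⋁ᶠ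
    ; ∙-distribʳ-⋁   = *-distribʳ-⋁ᶠ
    }

  private
    select-at : ∀ {F G : QS} x (b : Lift i Bool) →
                (if lower b then F else G) x ≈ (if lower b then F x else G x)
    select-at x (lift true)  = Eq.refl
    select-at x (lift false) = Eq.refl

  distributiveᶠ : Distributive _≈_ ⋁ ⋀ → Distributive _≈ᶠ_ ⋁ᶠ ⋀ᶠ
  distributiveᶠ (meet-distrib , join-distrib) =
      (λ F G x → Eq.trans (⋀-cong (select-at x)) (Eq.trans (meet-distrib (F x) (λ j → G j x))
                   (⋁-cong λ j → ⋀-cong λ b → Eq.sym (select-at x b))))
    , (λ F G x → Eq.trans (⋁-cong (select-at x)) (Eq.trans (join-distrib (F x) (λ j → G j x))
                   (⋀-cong λ j → ⋁-cong λ b → Eq.sym (select-at x b))))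

  commutativeᶠ : PSCommutative PS → Commutative _≈_ _∙_ → Commutative _≈ᶠ_ _*_
  commutativeᶠ S-comm Q-comm f g x = antisym (swap-≤ f g) (swap-≤ g f)
    where
    swap-≤ : ∀ f g → (f * g) x ≤ (g * f) x
    swap-≤ f g = *-least f g λ y z yz≡x →
      trans (reflexive (Q-comm (f y) (g z))) (*-upper g f (P.trans (S-comm z y) yz≡x))

  -- 𝟙 e u * f ≈ f: the only contributing factorisations are x = e·x, each
  -- contributing u ∙ f x ≈ f x; symmetrically for f * 𝟙 e u.
  unitᶠ : ∀ (e : Elt) (u : Carrier) → PSUnit PS e → IsUnit _≈_ _∙_ u → IsUnit _≈ᶠ_ _*_ (𝟙 e u)
  unitᶠ e u S-unit Q-unit f = (λ x → antisym (left-≤ x) (left-≥ x))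
                            , (λ x → antisym (right-≤ x) (right-≥ x))
    where
    u≤𝟙e : u ≤ 𝟙 e u e
    u≤𝟙e = ≤-⋁ P.refl refl

    ≡⇒≈ : ∀ {a b} → a ≡ b → f a ≈ f b
    ≡⇒≈ P.refl = Eq.refl

    left-≤ : ∀ x → (𝟙 e u * f) x ≤ f x
    left-≤ x = *-least (𝟙 e u) f λ y z yz≡x → ⋁∙-least _ (f z) λ { P.refl →
      trans (reflexive (proj₁ (Q-unit (f z))))
            (reflexive (≡⇒≈ (just-injective (P.trans (P.sym (proj₁ (S-unit z))) yz≡x)))) }

    left-≥ : ∀ x → f x ≤ (𝟙 e u * f) x
    left-≥ x = trans (reflexive (Eq.sym (proj₁ (Q-unit (f x)))))
                     (trans (∙-monoˡ (f x) u≤𝟙e) (*-upper (𝟙 e u) f (proj₁ (S-unit x))))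

    right-≤ : ∀ x → (f * 𝟙 e u) x ≤ f x
    right-≤ x = *-least f (𝟙 e u) λ y z yz≡x → ∙⋁-least (f y) _ λ { P.refl →
      trans (reflexive (proj₂ (Q-unit (f y))))
            (reflexive (≡⇒≈ (just-injective (P.trans (P.sym (proj₂ (S-unit y))) yz≡x)))) }

    right-≥ : ∀ x → f x ≤ (f * 𝟙 e u) x
    right-≥ x = trans (reflexive (Eq.sym (proj₂ (Q-unit (f x)))))
                      (trans (∙-monoʳ (f x) u≤𝟙e) (*-upper f (𝟙 e u) (proj₂ (S-unit x))))

theorem3p3 : ∀ {c ℓ₁ ℓ₂ i} (PS : PartialSemigroup i) (Q : Quantale c ℓ₁ ℓ₂ i) →
    let open FunctionQuantale PS Q
        open Quantale Q
        open PartialSemigroup PS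
    in IsQuantale _≈ᶠ_ _≤ᶠ_ ⋁ᶠ ⋀ᶠ _*_
       × (Distributive _≈_ ⋁ ⋀ → Distributive _≈ᶠ_ ⋁ᶠ ⋀ᶠ)
       × (PSCommutative PS → Commutative _≈_ _∙_ → Commutative _≈ᶠ_ _*_)
       × (∀ (e : Elt) (u : Carrier) → PSUnit PS e → IsUnit _≈_ _∙_ u → IsUnit _≈ᶠ_ _*_ (𝟙 e u))
theorem3p3 PS Q = isQuantaleᶠ , distributiveᶠ , commutativeᶠ , unitᶠ
  where open ConvolutionQuantale PS Q
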